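{- $\mathcal{P}(\supset)\not\leq\mathcal{P}(\Box\!\!\rightarrow)$.
   Context: Logics are evaluated on causal multiteams (finite multisets of assignments over a finite signature together with recursive structural equations). $\mathcal{PCO}$ is built from $\mathcal{CO}$ literals and probabilistic atoms $\Pr(\alpha)\geq\epsilon$, $\Pr(\alpha)>\epsilon$, $\Pr(\alpha)\geq\Pr(\beta)$, $\Pr(\alpha)>\Pr(\beta)$, closed under $\land$, global disjunction $\sqcup$, selective implication $\alpha\supset\varphi$ and interventionist counterfactual $\mathbf X=\mathbf x\,\Box\!\!\rightarrow\varphi$. $\mathcal{P}(\supset)$ is the fragment without $\Box\!\!\rightarrow$ and $\mathcal{P}(\Box\!\!\rightarrow)$ the fragment without $\supset$. $\mathcal L\leq\mathcal L'$ means every formula of $\mathcal L$ is equivalent (same satisfying causal multiteams) to some formula of $\mathcal L'$. -}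

module Defs where

open import Data.Nat using (ℕ; zero; suc; _+_; _*_; _≤_; _<_)
open import Data.Fin using (Fin)
open import Data.Fin.Properties using (_≟_)
open import Data.Bool using (Bool; true; false; _∧_; _∨_; not; if_then_else_)
open import Data.List using (List; []; length; map; filterᵇ)
open import Data.List.Relation.Unary.All using (All)
open import Data.Maybe using (Maybe; just; nothing; is-nothing)
open import Data.Product using (Σ; _×_)
open import Data.Sum using (_⊎_)
open import Relation.Binary.PropositionalEquality using (_≡_)
open import Relation.Nullary.Decidable using (⌊_⌋)
open import Relation.Nullary using (¬_)

record Sig : Set where
  field
    nVar : ℕ
    rng  : Fin nVar → ℕ
open Sig public

Val : (σ : Sig) → Fin (nVar σ) → Set
Val σ v = Fin (suc (rng σ v))

Asg : Sig → Set
Asg σ = (v : Fin (nVar σ)) → Val σ v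

-- an intervention X = x, as a partial map (consistent by construction)
Interv : Sig → Set
Interv σ = (v : Fin (nVar σ)) → Maybe (Val σ v)

-- Structural equations (raw data): the set of endogenous variables and,
-- for each variable, a function computing its value (only used for
-- endogenous variables).

record Model (σ : Sig) : Set where
  field
    endo : Fin (nVar σ) → Bool
    fn   : (v : Fin (nVar σ)) → Asg σ → Val σ v
open Model public

Recursive : {σ : Sig} → Model σ → Set
Recursive {σ} M =
  Σ (Fin (nVar σ) → ℕ) λ rank →
    ∀ v → endo M v ≡ true → ∀ (s t : Asg σ) →
      (∀ w → rank w < rank v → s w ≡ t w) → fn M v s ≡ fn M v t

-- causal multiteams (multiteam = list of assignments, i.e. a multiset)
record CMT (σ : Sig) : Set where
  constructor cmt
  field
    model : Model σ
    team  : List (Asg σ)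
open CMT public

Compatible : {σ : Sig} → CMT σ → Set
Compatible {σ} T =
  All (λ s → ∀ v → endo (model T) v ≡ true → s v ≡ fn (model T) v s) (team T)

ValidCMT : {σ : Sig} → CMT σ → Set
ValidCMT T = Recursive (model T) × Compatible T

intModel : {σ : Sig} → Interv σ → Model σ → Model σ
intModel X M = record
  { endo = λ v → endo M v ∧ is-nothing (X v)
  ; fn   = fn M }

private
  iter : {A : Set} → ℕ → (A → A) → A → A
  iter zero    f a = a
  iter (suc k) f a = f (iter k f a)

  step : {σ : Sig} → Interv σ → Model σ → Asg σ → Asg σ → Asg σ
  step X M s u v with X v
  ... | just x  = x
  ... | nothing = if endo M v then fn M v u else s v

-- s^F_{X=x}: the unique solution of the modified equations, obtained by
-- iterating the update nVar times (sufficient for recursive models).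
intAsg : {σ : Sig} → Interv σ → Model σ → Asg σ → Asg σ
intAsg {σ} X M s = iter (nVar σ) (step X M s) s

-- CO formulas α, indexed by flags: (selective implication allowed?)
-- (counterfactual allowed?)

data CO (σ : Sig) : Bool → Bool → Set where
  eq   : ∀ {a b} (v : Fin (nVar σ)) → Val σ v → CO σ a b
  neq  : ∀ {a b} (v : Fin (nVar σ)) → Val σ v → CO σ a b
  and  : ∀ {a b} → CO σ a b → CO σ a b → CO σ a b
  or   : ∀ {a b} → CO σ a b → CO σ a b → CO σ a b
  imp  : ∀ {b} → CO σ true b → CO σ true b → CO σ true b
  cf   : ∀ {a} → Interv σ → CO σ a true → CO σ a true

evalCO : ∀ {σ a b} → Model σ → Asg σ → CO σ a b → Bool
evalCO M s (eq v y)  = ⌊ s v ≟ y ⌋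
evalCO M s (neq v y) = not ⌊ s v ≟ y ⌋
evalCO M s (and α β) = evalCO M s α ∧ evalCO M s β
evalCO M s (or α β)  = evalCO M s α ∨ evalCO M s β
evalCO M s (imp α β) = not (evalCO M s α) ∨ evalCO M s β
evalCO M s (cf X α)  = evalCO (intModel X M) (intAsg X M s) α

-- PCO formulas, indexed by the same flags.
-- A threshold ε ∈ [0,1] ∩ ℚ is given as p / (suc q) with p ≤ suc q.

data PCO (σ : Sig) : Bool → Bool → Set where
  lit-eq  : ∀ {a b} (v : Fin (nVar σ)) → Val σ v → PCO σ a b
  lit-neq : ∀ {a b} (v : Fin (nVar σ)) → Val σ v → PCO σ a b
  prGe    : ∀ {a b} → CO σ a b → (p q : ℕ) → p ≤ suc q → PCO σ a b
  prGt    : ∀ {a b} → CO σ a b → (p q : ℕ) → p ≤ suc q → PCO σ a b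
  prGeP   : ∀ {a b} → CO σ a b → CO σ a b → PCO σ a b
  prGtP   : ∀ {a b} → CO σ a b → CO σ a b → PCO σ a b
  and     : ∀ {a b} → PCO σ a b → PCO σ a b → PCO σ a b
  gor     : ∀ {a b} → PCO σ a b → PCO σ a b → PCO σ a b
  sel     : ∀ {b} → CO σ true b → PCO σ true b → PCO σ true b
  cf      : ∀ {a} → Interv σ → PCO σ a true → PCO σ a true

count : ∀ {σ a b} → Model σ → List (Asg σ) → CO σ a b → ℕ
count M ss α = length (filterᵇ (λ s → evalCO M s α) ss)

-- multiteam semantics; probabilistic atoms hold trivially on the empty multiteam
_⊨_ : ∀ {σ a b} → CMT σ → PCO σ a b → Set
cmt M ts ⊨ lit-eq v y  = All (λ s → s v ≡ y) ts
cmt M ts ⊨ lit-neq v y = All (λ s → ¬ (s v ≡ y)) ts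
cmt M ts ⊨ prGe α p q _ = ts ≡ [] ⊎ p * length ts ≤ suc q * count M ts α
cmt M ts ⊨ prGt α p q _ = ts ≡ [] ⊎ p * length ts < suc q * count M ts α
cmt M ts ⊨ prGeP α β   = ts ≡ [] ⊎ count M ts β ≤ count M ts α
cmt M ts ⊨ prGtP α β   = ts ≡ [] ⊎ count M ts β < count M ts α
cmt M ts ⊨ and φ ψ     = (cmt M ts ⊨ φ) × (cmt M ts ⊨ ψ)
cmt M ts ⊨ gor φ ψ     = (cmt M ts ⊨ φ) ⊎ (cmt M ts ⊨ ψ)
cmt M ts ⊨ sel α φ     = cmt M (filterᵇ (λ s → evalCO M s α) ts) ⊨ φ
cmt M ts ⊨ cf X φ      = cmt (intModel X M) (map (intAsg X M) ts) ⊨ φ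

Equiv : ∀ {σ a b c d} → PCO σ a b → PCO σ c d → Set
Equiv {σ} φ ψ = ∀ (T : CMT σ) → ValidCMT T → (T ⊨ φ → T ⊨ ψ) × (T ⊨ ψ → T ⊨ φ)

P⊃ : Sig → Set
P⊃ σ = PCO σ true false

P□→ : Sig → Set
P□→ σ = PCO σ false true

P⊃≤P□→ : Set
P⊃≤P□→ = ∀ (σ : Sig) (φ : P⊃ σ) → Σ (P□→ σ) λ ψ → Equiv φ ψ

-- Let T(N, m) be the multiteam with N copies of a background assignment s₀,
-- m copies of s₁ and one copy of s₂.  Every P(□→) formula takes the same
-- value on T(N, 2) and T(N, 3) once N is large: interventions act pointwise,
-- so they map such multiteams to multiteams of the same shape, and a
-- probability atom compares numbers of the form N·x + (m·a + b) with bits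
-- x, a, b, which for large N are ordered lexicographically in their digits,
-- independently of m.  The P(⊃) formula  x = 1 ⊃ Pr(y = 1) ≥ 1/3  separates
-- the two multiteams: selecting x = 1 discards the background block and
-- leaves the probabilities 1/3 and 1/4.

module Submission where

open import Data.Bool using (Bool; true; false)
open import Data.Fin using (zero; suc)
open import Data.List using (List; []; _∷_; _++_; map; length; filterᵇ; replicate)
open import Data.List.Properties using (map-++; map-replicate; ++-conicalʳ)
open import Data.List.Relation.Unary.All using (All; universal)
open import Data.List.Relation.Unary.All.Properties using (++⁺; ++⁻ˡ; ++⁻ʳ; replicate⁺; replicate⁻)
open import Data.Nat using (ℕ; zero; suc; _+_; _*_; _≤_; _<_; _⊔_; z≤n; s≤s)
open import Data.Nat.Properties
open import Data.Product using (∃; _×_; _,_; proj₁; proj₂)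
open import Data.Product.Function.NonDependent.Propositional using (_×-⇔_)
open import Data.Sum using (_⊎_; inj₁; inj₂)
open import Data.Sum.Function.Propositional using (_⊎-⇔_)
open import Function.Bundles using (_⇔_; mk⇔; Equivalence)
open import Function.Construct.Composition using (_⇔-∘_)
open import Function.Construct.Identity using (⇔-id)
open import Function.Construct.Symmetry using (⇔-sym)
open import Function.Related.TypeIsomorphisms using (¬-cong-⇔)
open import Relation.Binary.Definitions using (tri<; tri≈; tri>)
open import Relation.Binary.PropositionalEquality
open import Relation.Nullary using (¬_; contradiction)

open import Defs

infixr 9 _⇔⟫_
_⇔⟫_ : {A B C : Set} → A ⇔ B → B ⇔ C → A ⇔ C
A⇔B ⇔⟫ B⇔C = B⇔C ⇔-∘ A⇔B

×-⇔-under : {A B C : Set} → (A → B ⇔ C) → (A × B) ⇔ (A × C)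
×-⇔-under B⇔C = mk⇔ (λ (a , b) → a , Equivalence.to (B⇔C a) b)
                    (λ (a , c) → a , Equivalence.from (B⇔C a) c)

⊎-⇔-absurdˡ : {X Y A B : Set} → ¬ X → ¬ Y → A ⇔ B → (X ⊎ A) ⇔ (Y ⊎ B)
⊎-⇔-absurdˡ ¬x ¬y A⇔B =
  mk⇔ (λ { (inj₁ x) → contradiction x ¬x ; (inj₂ a) → inj₂ (Equivalence.to A⇔B a) })
      (λ { (inj₁ y) → contradiction y ¬y ; (inj₂ b) → inj₂ (Equivalence.from A⇔B b) })

0≤-⇔ : ∀ {a b} → (0 ≤ a) ⇔ (0 ≤ b)
0≤-⇔ = mk⇔ (λ _ → z≤n) (λ _ → z≤n)

<⇔≱ : ∀ {a b} → (a < b) ⇔ (¬ b ≤ a)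
<⇔≱ = mk⇔ <⇒≱ ≰⇒>

*-identityˡ-≤ : ∀ a b → (1 * a ≤ 1 * b) ⇔ (a ≤ b)
*-identityˡ-≤ a b = mk⇔ (subst₂ _≤_ (*-identityˡ a) (*-identityˡ b))
                        (subst₂ _≤_ (sym (*-identityˡ a)) (sym (*-identityˡ b)))

-- Mixed-radix numerals with binary digits

bit : Bool → ℕ
bit false = 0
bit true  = 1

bit≤1 : ∀ b → bit b ≤ 1
bit≤1 false = z≤n
bit≤1 true  = ≤-refl

num₂ : ℕ → Bool → Bool → ℕ
num₂ m a b = bit a * m + bit b

num₃ : ℕ → ℕ → Bool → Bool → Bool → ℕ
num₃ N m x a b = bit x * N + num₂ m a b

*-+-<-carry : ∀ {n a b c} d → b < n → a < c → a * n + b < c * n + d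
*-+-<-carry {n} {a} {b} {c} d b<n a<c = begin-strict
  a * n + b  <⟨ +-monoʳ-< (a * n) b<n ⟩
  a * n + n  ≡⟨ +-comm (a * n) n ⟩
  suc a * n  ≤⟨ *-monoˡ-≤ n a<c ⟩
  c * n      ≤⟨ m≤m+n (c * n) d ⟩
  c * n + d  ∎
  where open ≤-Reasoning

*-+-≤-lex : ∀ {n a b c d} → b < n → d < n →
            (a * n + b ≤ c * n + d) ⇔ (a < c ⊎ (a ≡ c × b ≤ d))
*-+-≤-lex {n} {a} {b} {c} {d} b<n d<n = mk⇔ to from
  where
  to : a * n + b ≤ c * n + d → a < c ⊎ (a ≡ c × b ≤ d)
  to le with <-cmp a c
  ... | tri< a<c _ _  = inj₁ a<c
  ... | tri≈ _ refl _ = inj₂ (refl , +-cancelˡ-≤ (a * n) b d le)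
  ... | tri> _ _ c<a  = contradiction le (<⇒≱ (*-+-<-carry b d<n c<a))

  from : a < c ⊎ (a ≡ c × b ≤ d) → a * n + b ≤ c * n + d
  from (inj₁ a<c)          = <⇒≤ (*-+-<-carry d b<n a<c)
  from (inj₂ (refl , b≤d)) = +-monoʳ-≤ (a * n) b≤d

num₂-≤-radix-independent : ∀ {m m'} → 2 ≤ m → 2 ≤ m' → ∀ a b a' b' →
  (num₂ m a b ≤ num₂ m a' b') ⇔ (num₂ m' a b ≤ num₂ m' a' b')
num₂-≤-radix-independent 2≤m 2≤m' a b a' b' =
  *-+-≤-lex {a = bit a} {c = bit a'} (below 2≤m b) (below 2≤m b') ⇔⟫
  ⇔-sym (*-+-≤-lex (below 2≤m' b) (below 2≤m' b'))
  where
  below : ∀ {m} → 2 ≤ m → ∀ b → bit b < m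
  below 2≤m b = <-≤-trans (s≤s (bit≤1 b)) 2≤m

-- The cases in which  k * n ≤ k' * n'  is decided by comparing n with n'
-- (or trivially).
Cancellable : ℕ → ℕ → Set
Cancellable k k' = k ≡ k' ⊎ k ≡ 0 ⊎ k' ≡ 0

Cancellable-sym : ∀ {k k'} → Cancellable k k' → Cancellable k' k
Cancellable-sym (inj₁ k≡k')        = inj₁ (sym k≡k')
Cancellable-sym (inj₂ (inj₁ k≡0))  = inj₂ (inj₂ k≡0)
Cancellable-sym (inj₂ (inj₂ k'≡0)) = inj₂ (inj₁ k'≡0)

*-≤-cancel : ∀ k {n n'} → (suc k * n ≤ suc k * n') ⇔ (n ≤ n')
*-≤-cancel k = mk⇔ (*-cancelˡ-≤ (suc k)) (*-monoʳ-≤ (suc k))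

*-≤-0 : ∀ k {n} → (suc k * n ≤ 0) ⇔ (n ≤ 0)
*-≤-0 k {n} = mk⇔ (m+n≤o⇒m≤o n) from
  where
  from : n ≤ 0 → suc k * n ≤ 0
  from n≤0 rewrite n≤0⇒n≡0 n≤0 = ≤-reflexive (*-zeroʳ (suc k))

scaled-num₂-≤-radix-independent : ∀ {m m' k k'} → 2 ≤ m → 2 ≤ m' → Cancellable k k' →
  ∀ a b a' b' → (k * num₂ m a b ≤ k' * num₂ m a' b') ⇔ (k * num₂ m' a b ≤ k' * num₂ m' a' b')
scaled-num₂-≤-radix-independent {k = zero}  _ _ (inj₁ refl)        _ _ _ _ = 0≤-⇔
scaled-num₂-≤-radix-independent {k = suc k} 2≤m 2≤m' (inj₁ refl) a b a' b' =
  *-≤-cancel k ⇔⟫ num₂-≤-radix-independent 2≤m 2≤m' a b a' b' ⇔⟫ ⇔-sym (*-≤-cancel k)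
scaled-num₂-≤-radix-independent             _ _ (inj₂ (inj₁ refl)) _ _ _ _ = 0≤-⇔
scaled-num₂-≤-radix-independent {k = zero}  _ _ (inj₂ (inj₂ refl)) _ _ _ _ = 0≤-⇔
-- here the right-hand side is 0, the value of num₂ _ false false
scaled-num₂-≤-radix-independent {k = suc k} 2≤m 2≤m' (inj₂ (inj₂ refl)) a b _ _ =
  *-≤-0 k ⇔⟫ num₂-≤-radix-independent 2≤m 2≤m' a b false false ⇔⟫ ⇔-sym (*-≤-0 k)

*-num₃ : ∀ k N m x a b → k * num₃ N m x a b ≡ (k * bit x) * N + k * num₂ m a b
*-num₃ k N m x a b =
  trans (*-distribˡ-+ k (bit x * N) (num₂ m a b))
        (cong (_+ k * num₂ m a b) (sym (*-assoc k (bit x) N)))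

scaled-num₂-bound : ∀ {N m m' K k} → m ≤ m' → K * num₂ m' true true < N → k ≤ K →
  ∀ a b → k * num₂ m a b < N
scaled-num₂-bound m≤m' bound k≤K a b =
  ≤-<-trans (*-mono-≤ k≤K (+-mono-≤ (*-mono-≤ (bit≤1 a) m≤m') (bit≤1 b))) bound

-- For large N the top digits are compared first; the lower digits only
-- matter when the top digits agree, which is where Cancellable is needed.
scaled-num₃-≤-radix-independent : ∀ {N m m' K k k'} → 2 ≤ m → m ≤ m' →
  K * num₂ m' true true < N → k ≤ K → k' ≤ K →
  ∀ x a b x' a' b' → (k * bit x ≡ k' * bit x' → Cancellable k k') →
  (k * num₃ N m x a b ≤ k' * num₃ N m x' a' b') ⇔ (k * num₃ N m' x a b ≤ k' * num₃ N m' x' a' b')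
scaled-num₃-≤-radix-independent {N} {m} {m'} {K} {k} {k'} 2≤m m≤m' bound k≤K k'≤K
                                x a b x' a' b' cancellable =
  lex m≤m' ⇔⟫ (⇔-id _ ⊎-⇔ ×-⇔-under lower-digits) ⇔⟫ ⇔-sym (lex ≤-refl)
  where
  lex : ∀ {n} → n ≤ m' → (k * num₃ N n x a b ≤ k' * num₃ N n x' a' b') ⇔
        (k * bit x < k' * bit x' ⊎ (k * bit x ≡ k' * bit x' × k * num₂ n a b ≤ k' * num₂ n a' b'))
  lex {n} n≤m' rewrite *-num₃ k N n x a b | *-num₃ k' N n x' a' b' =
    *-+-≤-lex (scaled-num₂-bound n≤m' bound k≤K a b) (scaled-num₂-bound n≤m' bound k'≤K a' b')

  lower-digits : k * bit x ≡ k' * bit x' →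
    (k * num₂ m a b ≤ k' * num₂ m a' b') ⇔ (k * num₂ m' a b ≤ k' * num₂ m' a' b')
  lower-digits top≡ =
    scaled-num₂-≤-radix-independent 2≤m (≤-trans 2≤m m≤m') (cancellable top≡) a b a' b'

cancellable-against-1 : ∀ k k' x → k * 1 ≡ k' * bit x → Cancellable k k'
cancellable-against-1 k k' true  top≡ =
  inj₁ (trans (sym (*-identityʳ k)) (trans top≡ (*-identityʳ k')))
cancellable-against-1 k k' false top≡ =
  inj₂ (inj₁ (trans (sym (*-identityʳ k)) (trans top≡ (*-zeroʳ k'))))

-- The multiteams T(N, m)

blocks : {A : Set} → A → A → A → ℕ → ℕ → List A
blocks s₀ s₁ s₂ N m = replicate N s₀ ++ replicate m s₁ ++ s₂ ∷ []

module _ {A : Set} where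

  countᵇ : (A → Bool) → List A → ℕ
  countᵇ P xs = length (filterᵇ P xs)

  countᵇ-∷ : ∀ (P : A → Bool) x xs → countᵇ P (x ∷ xs) ≡ bit (P x) + countᵇ P xs
  countᵇ-∷ P x xs with P x
  ... | true  = refl
  ... | false = refl

  countᵇ-replicate-++ : ∀ (P : A → Bool) n x ys →
    countᵇ P (replicate n x ++ ys) ≡ bit (P x) * n + countᵇ P ys
  countᵇ-replicate-++ P zero    x ys = cong (_+ countᵇ P ys) (sym (*-zeroʳ (bit (P x))))
  countᵇ-replicate-++ P (suc n) x ys = begin
    countᵇ P (x ∷ replicate n x ++ ys)            ≡⟨ countᵇ-∷ P x (replicate n x ++ ys) ⟩
    bit (P x) + countᵇ P (replicate n x ++ ys)    ≡⟨ cong (bit (P x) +_) (countᵇ-replicate-++ P n x ys) ⟩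
    bit (P x) + (bit (P x) * n + countᵇ P ys)     ≡⟨ sym (+-assoc (bit (P x)) _ _) ⟩
    bit (P x) + bit (P x) * n + countᵇ P ys       ≡⟨ cong (_+ countᵇ P ys) (sym (*-suc (bit (P x)) n)) ⟩
    bit (P x) * suc n + countᵇ P ys               ∎
    where open ≡-Reasoning

  countᵇ-blocks : ∀ (P : A → Bool) s₀ s₁ s₂ N m →
    countᵇ P (blocks s₀ s₁ s₂ N m) ≡ num₃ N m (P s₀) (P s₁) (P s₂)
  countᵇ-blocks P s₀ s₁ s₂ N m = begin
    countᵇ P (replicate N s₀ ++ replicate m s₁ ++ s₂ ∷ [])
      ≡⟨ countᵇ-replicate-++ P N s₀ _ ⟩
    bit (P s₀) * N + countᵇ P (replicate m s₁ ++ s₂ ∷ [])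
      ≡⟨ cong (bit (P s₀) * N +_) (countᵇ-replicate-++ P m s₁ _) ⟩
    bit (P s₀) * N + (bit (P s₁) * m + countᵇ P (s₂ ∷ []))
      ≡⟨ cong (λ c → bit (P s₀) * N + (bit (P s₁) * m + c))
              (trans (countᵇ-∷ P s₂ []) (+-identityʳ _)) ⟩
    num₃ N m (P s₀) (P s₁) (P s₂)
      ∎
    where open ≡-Reasoning

  length-as-countᵇ : ∀ xs → length xs ≡ countᵇ (λ _ → true) xs
  length-as-countᵇ []       = refl
  length-as-countᵇ (_ ∷ xs) = cong suc (length-as-countᵇ xs)

  blocks-nonempty : ∀ (s₀ s₁ s₂ : A) N m → ¬ (blocks s₀ s₁ s₂ N m ≡ [])
  blocks-nonempty s₀ s₁ _ N m empty =
    contradiction (++-conicalʳ (replicate m s₁) _ (++-conicalʳ (replicate N s₀) _ empty)) λ ()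

  All-blocks-resize : ∀ {P : A → Set} s₀ s₁ s₂ N {m} m' → 1 ≤ m →
    All P (blocks s₀ s₁ s₂ N m) → All P (blocks s₀ s₁ s₂ N m')
  All-blocks-resize s₀ s₁ _ N {suc m} m' _ all =
    ++⁺ (++⁻ˡ (replicate N s₀) all)
        (++⁺ (replicate⁺ m' (replicate⁻ (++⁻ˡ (replicate (suc m) s₁) rest)))
             (++⁻ʳ (replicate (suc m) s₁) rest))
    where rest = ++⁻ʳ (replicate N s₀) all

  filterᵇ-replicate-++ : ∀ (P : A → Bool) n x ys → P x ≡ false →
    filterᵇ P (replicate n x ++ ys) ≡ filterᵇ P ys
  filterᵇ-replicate-++ P zero    x ys _ = refl
  filterᵇ-replicate-++ P (suc n) x ys Px≡false rewrite Px≡false =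
    filterᵇ-replicate-++ P n x ys Px≡false

map-blocks : ∀ {A B : Set} (f : A → B) s₀ s₁ s₂ N m →
  map f (blocks s₀ s₁ s₂ N m) ≡ blocks (f s₀) (f s₁) (f s₂) N m
map-blocks f s₀ s₁ s₂ N m = begin
  map f (replicate N s₀ ++ replicate m s₁ ++ s₂ ∷ [])
    ≡⟨ map-++ f (replicate N s₀) _ ⟩
  map f (replicate N s₀) ++ map f (replicate m s₁ ++ s₂ ∷ [])
    ≡⟨ cong₂ _++_ (map-replicate f N s₀)
                  (trans (map-++ f (replicate m s₁) _) (cong (_++ _) (map-replicate f m s₁))) ⟩
  blocks (f s₀) (f s₁) (f s₂) N m
    ∎
  where open ≡-Reasoning

countᵇ-blocks-≤-radix-independent : ∀ {A : Set} {N m m' K k k'} → 2 ≤ m → m ≤ m' →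
  K * num₂ m' true true < N → k ≤ K → k' ≤ K → ∀ (P Q : A → Bool) s₀ s₁ s₂ →
  (k * bit (P s₀) ≡ k' * bit (Q s₀) → Cancellable k k') →
  (k * countᵇ P (blocks s₀ s₁ s₂ N m) ≤ k' * countᵇ Q (blocks s₀ s₁ s₂ N m)) ⇔
  (k * countᵇ P (blocks s₀ s₁ s₂ N m') ≤ k' * countᵇ Q (blocks s₀ s₁ s₂ N m'))
countᵇ-blocks-≤-radix-independent {N = N} {m} {m'} 2≤m m≤m' bound k≤K k'≤K
                                  P Q s₀ s₁ s₂ cancellable
  rewrite countᵇ-blocks P s₀ s₁ s₂ N m | countᵇ-blocks Q s₀ s₁ s₂ N m
        | countᵇ-blocks P s₀ s₁ s₂ N m' | countᵇ-blocks Q s₀ s₁ s₂ N m' =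
  scaled-num₃-≤-radix-independent 2≤m m≤m' bound k≤K k'≤K
    (P s₀) (P s₁) (P s₂) (Q s₀) (Q s₁) (Q s₂) cancellable

-- P(□→) formulas do not see the size of the s₁ block once N is large

module Agreement {σ : Sig} {m m' : ℕ} (2≤m : 2 ≤ m) (m≤m' : m ≤ m') where

  AgreeFrom : P□→ σ → ℕ → Set
  AgreeFrom ψ N₀ = ∀ N → N₀ ≤ N → ∀ M (s₀ s₁ s₂ : Asg σ) →
    (cmt M (blocks s₀ s₁ s₂ N m) ⊨ ψ) ⇔ (cmt M (blocks s₀ s₁ s₂ N m') ⊨ ψ)

  bound : ℕ → ℕ
  bound K = suc (K * num₂ m' true true)

  counts-≤ : ∀ N → bound 1 ≤ N → ∀ M (α β : CO σ false true) (s₀ s₁ s₂ : Asg σ) →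
    (count M (blocks s₀ s₁ s₂ N m) β ≤ count M (blocks s₀ s₁ s₂ N m) α) ⇔
    (count M (blocks s₀ s₁ s₂ N m') β ≤ count M (blocks s₀ s₁ s₂ N m') α)
  counts-≤ N N₀≤N M α β s₀ s₁ s₂ =
    ⇔-sym (*-identityˡ-≤ _ _) ⇔⟫
    countᵇ-blocks-≤-radix-independent {K = 1} 2≤m m≤m' N₀≤N ≤-refl ≤-refl
      (λ s → evalCO M s β) (λ s → evalCO M s α) s₀ s₁ s₂ (λ _ → inj₁ refl) ⇔⟫
    *-identityˡ-≤ _ _

  length-count-≤ : ∀ N {p q} → p ≤ suc q → bound (suc q) ≤ N →
    ∀ M (α : CO σ false true) (s₀ s₁ s₂ : Asg σ) →
    (p * length (blocks s₀ s₁ s₂ N m) ≤ suc q * count M (blocks s₀ s₁ s₂ N m) α) ⇔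
    (p * length (blocks s₀ s₁ s₂ N m') ≤ suc q * count M (blocks s₀ s₁ s₂ N m') α)
  length-count-≤ N {p} {q} p≤1+q N₀≤N M α s₀ s₁ s₂
    rewrite length-as-countᵇ (blocks s₀ s₁ s₂ N m) | length-as-countᵇ (blocks s₀ s₁ s₂ N m') =
    countᵇ-blocks-≤-radix-independent {K = suc q} 2≤m m≤m' N₀≤N p≤1+q ≤-refl
      (λ _ → true) (λ s → evalCO M s α) s₀ s₁ s₂ (cancellable-against-1 p (suc q) _)

  count-length-≤ : ∀ N {p q} → p ≤ suc q → bound (suc q) ≤ N →
    ∀ M (α : CO σ false true) (s₀ s₁ s₂ : Asg σ) →
    (suc q * count M (blocks s₀ s₁ s₂ N m) α ≤ p * length (blocks s₀ s₁ s₂ N m)) ⇔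
    (suc q * count M (blocks s₀ s₁ s₂ N m') α ≤ p * length (blocks s₀ s₁ s₂ N m'))
  count-length-≤ N {p} {q} p≤1+q N₀≤N M α s₀ s₁ s₂
    rewrite length-as-countᵇ (blocks s₀ s₁ s₂ N m) | length-as-countᵇ (blocks s₀ s₁ s₂ N m') =
    countᵇ-blocks-≤-radix-independent {K = suc q} 2≤m m≤m' N₀≤N ≤-refl p≤1+q
      (λ s → evalCO M s α) (λ _ → true) s₀ s₁ s₂
      (λ top≡ → Cancellable-sym (cancellable-against-1 p (suc q) _ (sym top≡)))

  nonempty-atom : ∀ N (s₀ s₁ s₂ : Asg σ) {A B : Set} → A ⇔ B →
    (blocks s₀ s₁ s₂ N m ≡ [] ⊎ A) ⇔ (blocks s₀ s₁ s₂ N m' ≡ [] ⊎ B)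
  nonempty-atom N s₀ s₁ s₂ =
    ⊎-⇔-absurdˡ (blocks-nonempty s₀ s₁ s₂ N m) (blocks-nonempty s₀ s₁ s₂ N m')

  All-blocks : ∀ {P : Asg σ → Set} N (s₀ s₁ s₂ : Asg σ) →
    All P (blocks s₀ s₁ s₂ N m) ⇔ All P (blocks s₀ s₁ s₂ N m')
  All-blocks N s₀ s₁ s₂ =
    mk⇔ (All-blocks-resize s₀ s₁ s₂ N m' 1≤m) (All-blocks-resize s₀ s₁ s₂ N m (≤-trans 1≤m m≤m'))
    where 1≤m = ≤-trans (s≤s z≤n) 2≤m

  eventually-agree : (ψ : P□→ σ) → ∃ (AgreeFrom ψ)
  eventually-agree (lit-eq v y)  = 0 , λ N _ _ → All-blocks N
  eventually-agree (lit-neq v y) = 0 , λ N _ _ → All-blocks N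
  eventually-agree (prGe α p q p≤1+q) = bound (suc q) , λ N N₀≤N M s₀ s₁ s₂ →
    nonempty-atom N s₀ s₁ s₂ (length-count-≤ N p≤1+q N₀≤N M α s₀ s₁ s₂)
  eventually-agree (prGt α p q p≤1+q) = bound (suc q) , λ N N₀≤N M s₀ s₁ s₂ →
    nonempty-atom N s₀ s₁ s₂ (<⇔≱ ⇔⟫ ¬-cong-⇔ (count-length-≤ N p≤1+q N₀≤N M α s₀ s₁ s₂) ⇔⟫ ⇔-sym <⇔≱)
  eventually-agree (prGeP α β) = bound 1 , λ N N₀≤N M s₀ s₁ s₂ →
    nonempty-atom N s₀ s₁ s₂ (counts-≤ N N₀≤N M α β s₀ s₁ s₂)
  eventually-agree (prGtP α β) = bound 1 , λ N N₀≤N M s₀ s₁ s₂ →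
    nonempty-atom N s₀ s₁ s₂ (<⇔≱ ⇔⟫ ¬-cong-⇔ (counts-≤ N N₀≤N M β α s₀ s₁ s₂) ⇔⟫ ⇔-sym <⇔≱)
  eventually-agree (and φ ψ) with eventually-agree φ | eventually-agree ψ
  ... | N₁ , agree₁ | N₂ , agree₂ = N₁ ⊔ N₂ , λ N N₀≤N M s₀ s₁ s₂ →
    agree₁ N (≤-trans (m≤m⊔n N₁ N₂) N₀≤N) M s₀ s₁ s₂ ×-⇔
    agree₂ N (≤-trans (m≤n⊔m N₁ N₂) N₀≤N) M s₀ s₁ s₂
  eventually-agree (gor φ ψ) with eventually-agree φ | eventually-agree ψ
  ... | N₁ , agree₁ | N₂ , agree₂ = N₁ ⊔ N₂ , λ N N₀≤N M s₀ s₁ s₂ →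
    agree₁ N (≤-trans (m≤m⊔n N₁ N₂) N₀≤N) M s₀ s₁ s₂ ⊎-⇔
    agree₂ N (≤-trans (m≤n⊔m N₁ N₂) N₀≤N) M s₀ s₁ s₂
  eventually-agree (cf X φ) with eventually-agree φ
  ... | N₀ , agree = N₀ , λ N N₀≤N M s₀ s₁ s₂ →
    subst₂ (λ t t' → (cmt (intModel X M) t ⊨ φ) ⇔ (cmt (intModel X M) t' ⊨ φ))
      (sym (map-blocks (intAsg X M) s₀ s₁ s₂ N m)) (sym (map-blocks (intAsg X M) s₀ s₁ s₂ N m'))
      (agree N N₀≤N (intModel X M) (intAsg X M s₀) (intAsg X M s₁) (intAsg X M s₂))

-- A P(⊃) formula that does see it

σ₂ : Sig
σ₂ = record { nVar = 2 ; rng = λ _ → 1 }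

-- The values of (X, Y), with X = zero and Y = suc zero: (0,0), (1,0), (1,1).
a₀ a₁ a₂ : Asg σ₂
a₀ _       = zero
a₁ zero    = suc zero
a₁ (suc _) = zero
a₂ _       = suc zero

exogenous : Model σ₂
exogenous = record { endo = λ _ → false ; fn = λ v s → s v }

exogenous-valid : ∀ ts → ValidCMT (cmt exogenous ts)
exogenous-valid ts = ((λ _ → 0) , λ _ ()) , universal (λ _ _ ()) ts

X≡1 : CO σ₂ true false
X≡1 = eq zero (suc zero)

separator : P⊃ σ₂
separator = sel X≡1 (prGe (eq (suc zero) (suc zero)) 1 2 (s≤s z≤n))

selection-discards-a₀ : ∀ N m →
  filterᵇ (λ s → evalCO exogenous s X≡1) (blocks a₀ a₁ a₂ N m) ≡
  filterᵇ (λ s → evalCO exogenous s X≡1) (replicate m a₁ ++ a₂ ∷ [])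
selection-discards-a₀ N m = filterᵇ-replicate-++ (λ s → evalCO exogenous s X≡1) N a₀ _ refl

separator-holds-at-2 : ∀ N → cmt exogenous (blocks a₀ a₁ a₂ N 2) ⊨ separator
separator-holds-at-2 N rewrite selection-discards-a₀ N 2 = inj₂ ≤-refl

separator-fails-at-3 : ∀ N → ¬ (cmt exogenous (blocks a₀ a₁ a₂ N 3) ⊨ separator)
separator-fails-at-3 N rewrite selection-discards-a₀ N 3 =
  λ { (inj₁ ()) ; (inj₂ (s≤s (s≤s (s≤s ())))) }

corollary2 : ¬ P⊃≤P□→
corollary2 P⊃≤P□→ with P⊃≤P□→ σ₂ separator
... | ψ , separator≈ψ with Agreement.eventually-agree {m = 2} {m' = 3} ≤-refl (n≤1+n 2) ψ
... | N , agree =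
  separator-fails-at-3 N (proj₂ (separator≈ψ T₃ (exogenous-valid _)) ψ-at-3)
  where
  T₂ T₃ : CMT σ₂
  T₂ = cmt exogenous (blocks a₀ a₁ a₂ N 2)
  T₃ = cmt exogenous (blocks a₀ a₁ a₂ N 3)

  ψ-at-2 : T₂ ⊨ ψ
  ψ-at-2 = proj₁ (separator≈ψ T₂ (exogenous-valid _)) (separator-holds-at-2 N)

  ψ-at-3 : T₃ ⊨ ψ
  ψ-at-3 = Equivalence.to (agree N ≤-refl exogenous a₀ a₁ a₂) ψ-at-2
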